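{- Let $K_n$ be the complete graph whose vertices are the standard basis vectors $\epsilon_1,\dots,\epsilon_n$ of $\mathbb{R}^n$, with the connection $\nabla$ given by $\nabla_{(\epsilon_i,\epsilon_j)}(\epsilon_i,\epsilon_j)=(\epsilon_j,\epsilon_i)$ and $\nabla_{(\epsilon_i,\epsilon_j)}(\epsilon_i,\epsilon_k)=(\epsilon_j,\epsilon_k)$ for $k\ne i,j$. Then every closed geodesic of $(K_n,\nabla)$ is a triangle, and the connected totally geodesic subgraphs of $K_n$ are exactly the complete subgraphs (a subset of the vertices together with all edges between them).
   Context: A closed geodesic is a cyclic sequence of oriented edges $e_1,\dots,e_m$ (indices mod $m$) with $\tau(e_i)=\iota(e_{i+1})$ such that for each $i$, writing $e_i=(x,y)$, $e_{i+1}=(y,z)$, $e_{i+2}=(z,w)$, one has $\nabla_{(y,z)}(y,x)=(z,w)$. A subgraph $(V_0,E_0)$ is totally geodesic if for every edge $(x,y)\in E_0$, $\nabla_{(x,y)}(\mathrm{star}(x)\cap E_0)\subseteq E_0$, where $\mathrm{star}(x)$ denotes the set of oriented edges starting at $x$. -}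

module Defs where

open import Data.Nat using (ℕ; suc; _+_; _≤_)
open import Data.Nat.DivMod using (_mod_)
open import Data.Fin using (Fin; zero; suc; _≟_)
open import Data.Product using (_×_; _,_; ∃; ∃-syntax)
open import Relation.Nullary using (yes; no)
open import Relation.Binary.PropositionalEquality using (_≡_; _≢_; sym)

-- Vertices of K_n: the basis vectors ε_1..ε_n, indexed by Fin n.
-- Oriented edges of K_n: ordered pairs of distinct vertices.
record Edge (n : ℕ) : Set where
  constructor edge
  field
    src : Fin n
    tgt : Fin n
    .distinct : src ≢ tgt
open Edge public

rev : ∀ {n} → Edge n → Edge n
rev (edge x y d) = edge y x (λ p → d (sym p))

∇ : ∀ {n} (e f : Edge n) → src f ≡ src e → Edge n
∇ (edge i j d) (edge i' k d') p with k ≟ j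
... | yes _  = edge j i (λ q → d (sym q))
... | no k≢j = edge j k (λ q → k≢j (sym q))

record ClosedGeodesic {n : ℕ} (m : ℕ) (e : ℕ → Edge n) : Set where
  field
    length-pos : 1 ≤ m
    periodic   : ∀ i → e (i + m) ≡ e i
    chain      : ∀ i → tgt (e i) ≡ src (e (suc i))
    geodesic   : ∀ i → ∇ (e (suc i)) (rev (e i)) (chain i) ≡ e (suc (suc i))

IsTriangle : ∀ {n} → (ℕ → Edge n) → Set
IsTriangle {n} e = ∃[ a ] ∃[ b ] ∃[ c ]
  (a ≢ b × b ≢ c × a ≢ c ×
   (∀ i → (src (e i) , tgt (e i)) ≡ side a b c (i mod 3)))
  where
  side : Fin n → Fin n → Fin n → Fin 3 → Fin n × Fin n
  side a b c zero = a , b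
  side a b c (suc zero) = b , c
  side a b c (suc (suc zero)) = c , a

-- The degenerate closed geodesic going back and forth along one edge a — b.
IsBackAndForth : ∀ {n} → (ℕ → Edge n) → Set
IsBackAndForth {n} e = ∃[ a ] ∃[ b ]
  (a ≢ b × (∀ i → (src (e i) , tgt (e i)) ≡ side a b (i mod 2)))
  where
  side : Fin n → Fin n → Fin 2 → Fin n × Fin n
  side a b zero = a , b
  side a b (suc zero) = b , a

record IsSubgraph {n : ℕ} (V₀ : Fin n → Set) (E₀ : Edge n → Set) : Set where
  field
    endpoints : ∀ e → E₀ e → V₀ (src e) × V₀ (tgt e)
    symmetric : ∀ e → E₀ e → E₀ (rev e)

data Path {n : ℕ} (E₀ : Edge n → Set) : Fin n → Fin n → Set where
  here : ∀ {x} → Path E₀ x x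
  step : ∀ {z} (e : Edge n) → E₀ e → Path E₀ (tgt e) z → Path E₀ (src e) z

Connected : ∀ {n} → (Fin n → Set) → (Edge n → Set) → Set
Connected V₀ E₀ = ∀ x y → V₀ x → V₀ y → Path E₀ x y

TotallyGeodesic : ∀ {n} → (Fin n → Set) → (Edge n → Set) → Set
TotallyGeodesic V₀ E₀ =
  ∀ e → E₀ e → ∀ f (p : src f ≡ src e) → E₀ f → E₀ (∇ e f p)

Complete : ∀ {n} → (Fin n → Set) → (Edge n → Set) → Set
Complete V₀ E₀ = ∀ e → (E₀ e → V₀ (src e) × V₀ (tgt e))
                     × (V₀ (src e) × V₀ (tgt e) → E₀ e)

{-# OPTIONS --safe #-}
-- Describe a geodesic by its vertex sequence v.  The connection forces
-- v (i+3) = v i when v i ≠ v (i+2), and v (i+3) = v (i+1) when v i = v (i+2);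
-- each of the two conditions then holds again at i+1, so the first three
-- vertices decide between a triangle and a path back and forth along one edge.
-- In a subgraph, ∇ turns the edges (w,x) and (w,y) into (x,y); walking a path
-- from x, total geodesy therefore yields the edge from x to every later vertex,
-- so a connected totally geodesic subgraph is complete.  Conversely ∇ only
-- produces edges between endpoints of its arguments, so a complete subgraph is
-- closed under it.
module Submission where

open import Defs
open import Data.Nat using (ℕ; zero; suc; _+_; _*_; _/_; _%_; NonZero)
open import Data.Nat.DivMod using (_mod_; m≡m%n+[m/n]*n)
open import Data.Nat.Properties using (+-assoc; +-comm; +-suc)
open import Data.Fin using (Fin; toℕ; _≟_)
import Data.Fin as Fin
open import Data.Fin.Properties using (toℕ-fromℕ<)
open import Data.Product using (_×_; _,_; proj₁; proj₂; uncurry; <_,_>)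
open import Data.Sum using (_⊎_; inj₁; inj₂)
open import Data.Empty using (⊥-elim; ⊥-elim-irr)
open import Relation.Nullary using (yes; no)
open import Relation.Binary.PropositionalEquality
open ≡-Reasoning

module _ {X : Set} (p : ℕ) .{{_ : NonZero p}} where

  periodic-+* : {f : ℕ → X} → (∀ i → f (p + i) ≡ f i) → ∀ k i → f (k * p + i) ≡ f i
  periodic-+* periodic zero    i = refl
  periodic-+* {f} periodic (suc k) i = begin
    f (p + k * p + i)   ≡⟨ cong f (+-assoc p (k * p) i) ⟩
    f (p + (k * p + i)) ≡⟨ periodic (k * p + i) ⟩
    f (k * p + i)       ≡⟨ periodic-+* periodic k i ⟩
    f i                 ∎

  periodic⇒≡-mod : {f : ℕ → X} → (∀ i → f (p + i) ≡ f i) → ∀ i → f i ≡ f (toℕ (i mod p))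
  periodic⇒≡-mod {f} periodic i = begin
    f i                     ≡⟨ cong f (m≡m%n+[m/n]*n i p) ⟩
    f (i % p + i / p * p)   ≡⟨ cong f (+-comm (i % p) (i / p * p)) ⟩
    f (i / p * p + i % p)   ≡⟨ periodic-+* periodic (i / p) (i % p) ⟩
    f (i % p)               ≡⟨ cong f (toℕ-fromℕ< _) ⟨
    f (toℕ (i mod p))       ∎

  periodic-agree : {f g : ℕ → X} →
                   (∀ i → f (p + i) ≡ f i) → (∀ i → g (p + i) ≡ g i) →
                   (∀ (k : Fin p) → f (toℕ k) ≡ g (toℕ k)) → ∀ i → f i ≡ g i
  periodic-agree {f} {g} f-periodic g-periodic agree i = begin
    f i                 ≡⟨ periodic⇒≡-mod f-periodic i ⟩
    f (toℕ (i mod p))   ≡⟨ agree (i mod p) ⟩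
    g (toℕ (i mod p))   ≡⟨ periodic⇒≡-mod g-periodic i ⟨
    g i                 ∎

src≢tgt : ∀ {n} (e : Edge n) → src e ≢ tgt e
src≢tgt (edge x y x≢y) x≡y = ⊥-elim-irr (x≢y x≡y)

src-∇ : ∀ {n} (e f : Edge n) p → src (∇ e f p) ≡ tgt e
src-∇ (edge i j _) (edge _ k _) p with k ≟ j
... | yes _ = refl
... | no  _ = refl

tgt-∇ : ∀ {n} (e f : Edge n) p → tgt (∇ e f p) ≡ src e ⊎ tgt (∇ e f p) ≡ tgt f
tgt-∇ (edge i j _) (edge _ k _) p with k ≟ j
... | yes _ = inj₁ refl
... | no  _ = inj₂ refl

∇-self : ∀ {n} (e f : Edge n) p → tgt f ≡ tgt e → ∇ e f p ≡ rev e
∇-self (edge i j _) (edge _ k _) p k≡j with k ≟ j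
... | yes _   = refl
... | no  k≢j = ⊥-elim (k≢j k≡j)

∇-other : ∀ {n} (e f : Edge n) p (f≢e : tgt f ≢ tgt e) →
          ∇ e f p ≡ edge (tgt e) (tgt f) (λ q → f≢e (sym q))
∇-other (edge i j _) (edge _ k _) p k≢j with k ≟ j
... | yes k≡j = ⊥-elim (k≢j k≡j)
... | no  _   = refl

ends : ∀ {n} → Edge n → Fin n × Fin n
ends e = src e , tgt e

module GeodesicSequence {n : ℕ} (e : ℕ → Edge n)
  (chain    : ∀ i → tgt (e i) ≡ src (e (suc i)))
  (geodesic : ∀ i → ∇ (e (suc i)) (rev (e i)) (chain i) ≡ e (suc (suc i)))
  where

  vertex : ℕ → Fin n
  vertex i = src (e i)

  ends-vertex : ∀ i → ends (e i) ≡ (vertex i , vertex (suc i))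
  ends-vertex i = cong (vertex i ,_) (chain i)

  vertex-≢-suc : ∀ i → vertex i ≢ vertex (suc i)
  vertex-≢-suc i eq = src≢tgt (e i) (trans eq (sym (chain i)))

  vertex-3+ : ∀ i → vertex (3 + i) ≡ tgt (∇ (e (1 + i)) (rev (e i)) (chain i))
  vertex-3+ i = trans (sym (chain (2 + i))) (cong tgt (sym (geodesic i)))

  vertex-back : ∀ i → vertex i ≡ vertex (2 + i) → vertex (3 + i) ≡ vertex (1 + i)
  vertex-back i eq = trans (vertex-3+ i)
    (cong tgt (∇-self (e (1 + i)) (rev (e i)) (chain i) (trans eq (sym (chain (1 + i))))))

  vertex-turn : ∀ i → vertex i ≢ vertex (2 + i) → vertex (3 + i) ≡ vertex i
  vertex-turn i neq = trans (vertex-3+ i)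
    (cong tgt (∇-other (e (1 + i)) (rev (e i)) (chain i) λ eq → neq (trans eq (chain (1 + i)))))

  always-turn : vertex 0 ≢ vertex 2 → ∀ i → vertex i ≢ vertex (2 + i)
  always-turn neq zero    = neq
  always-turn neq (suc i) eq =
    vertex-≢-suc i (sym (trans eq (vertex-turn i (always-turn neq i))))

  always-back : vertex 0 ≡ vertex 2 → ∀ i → vertex i ≡ vertex (2 + i)
  always-back eq zero    = eq
  always-back eq (suc i) = sym (vertex-back i (always-back eq i))

  ends-periodic : ∀ p → (∀ i → vertex (p + i) ≡ vertex i) → ∀ i → ends (e (p + i)) ≡ ends (e i)
  ends-periodic p periodic i = begin
    ends (e (p + i))                      ≡⟨ ends-vertex (p + i) ⟩
    vertex (p + i) , vertex (suc (p + i)) ≡⟨ cong₂ _,_ (periodic i) periodic-suc ⟩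
    vertex i , vertex (suc i)             ≡⟨ ends-vertex i ⟨
    ends (e i)                            ∎
    where
    periodic-suc : vertex (suc (p + i)) ≡ vertex (suc i)
    periodic-suc = trans (cong vertex (sym (+-suc p i))) (periodic (suc i))

  -- The side functions of IsTriangle and IsBackAndForth are periodic by
  -- computation: (p + i) mod p reduces to i mod p for a literal p.
  triangle : vertex 0 ≢ vertex 2 → IsTriangle e
  triangle neq = vertex 0 , vertex 1 , vertex 2 , vertex-≢-suc 0 , vertex-≢-suc 1 , neq ,
    periodic-agree 3 (ends-periodic 3 period-3) (λ _ → refl) λ where
      Fin.zero                     → ends-vertex 0
      (Fin.suc Fin.zero)           → ends-vertex 1
      (Fin.suc (Fin.suc Fin.zero)) → trans (ends-vertex 2) (cong (vertex 2 ,_) (period-3 0))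
    where
    period-3 : ∀ i → vertex (3 + i) ≡ vertex i
    period-3 i = vertex-turn i (always-turn neq i)

  back-and-forth : vertex 0 ≡ vertex 2 → IsBackAndForth e
  back-and-forth eq = vertex 0 , vertex 1 , vertex-≢-suc 0 ,
    periodic-agree 2 (ends-periodic 2 period-2) (λ _ → refl) λ where
      Fin.zero           → ends-vertex 0
      (Fin.suc Fin.zero) → trans (ends-vertex 1) (cong (vertex 1 ,_) (period-2 0))
    where
    period-2 : ∀ i → vertex (2 + i) ≡ vertex i
    period-2 i = sym (always-back eq i)

  triangle-or-back-and-forth : IsTriangle e ⊎ IsBackAndForth e
  triangle-or-back-and-forth with vertex 0 ≟ vertex 2
  ... | yes eq  = inj₂ (back-and-forth eq)
  ... | no  neq = inj₁ (triangle neq)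

module _ {n : ℕ} {V₀ : Fin n → Set} {E₀ : Edge n → Set} where

  path⇒edge : IsSubgraph V₀ E₀ → TotallyGeodesic V₀ E₀ →
              ∀ {x y} → Path E₀ x y → (x≢y : x ≢ y) → E₀ (edge x y x≢y)
  path⇒edge S tg here x≢x = ⊥-elim (x≢x refl)
  path⇒edge S tg {y = y} (step (edge x w x≢w) xw∈E₀ path) x≢y with w ≟ y
  ... | yes refl = xw∈E₀
  ... | no  w≢y  = subst E₀ (∇-other wx wy refl λ y≡x → x≢y (sym y≡x))
                     (tg wx (IsSubgraph.symmetric S _ xw∈E₀) wy refl (path⇒edge S tg path w≢y))
    where
    wx wy : Edge n
    wx = rev (edge x w x≢w)
    wy = edge w y w≢y

  connected∧totallyGeodesic⇒complete : IsSubgraph V₀ E₀ →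
    Connected V₀ E₀ → TotallyGeodesic V₀ E₀ → Complete V₀ E₀
  connected∧totallyGeodesic⇒complete S connected tg (edge x y x≢y) =
    IsSubgraph.endpoints S _ ,
    λ (x∈V₀ , y∈V₀) → path⇒edge S tg (connected x y x∈V₀ y∈V₀) λ x≡y → ⊥-elim-irr (x≢y x≡y)

  complete⇒connected : Complete V₀ E₀ → Connected V₀ E₀
  complete⇒connected complete x y x∈V₀ y∈V₀ with x ≟ y
  ... | yes refl = here
  ... | no  x≢y  = step (edge x y x≢y) (proj₂ (complete _) (x∈V₀ , y∈V₀)) here

  complete⇒totallyGeodesic : Complete V₀ E₀ → TotallyGeodesic V₀ E₀
  complete⇒totallyGeodesic complete e e∈E₀ f p f∈E₀ =
    proj₂ (complete (∇ e f p)) (src-∈ , tgt-∈ (tgt-∇ e f p))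
    where
    ends-e∈V₀ : V₀ (src e) × V₀ (tgt e)
    ends-e∈V₀ = proj₁ (complete e) e∈E₀
    src-∈ : V₀ (src (∇ e f p))
    src-∈ = subst V₀ (sym (src-∇ e f p)) (proj₂ ends-e∈V₀)
    tgt-∈ : tgt (∇ e f p) ≡ src e ⊎ tgt (∇ e f p) ≡ tgt f → V₀ (tgt (∇ e f p))
    tgt-∈ (inj₁ eq) = subst V₀ (sym eq) (proj₁ ends-e∈V₀)
    tgt-∈ (inj₂ eq) = subst V₀ (sym eq) (proj₂ (proj₁ (complete f) f∈E₀))

mainTheorem12 : (∀ (n m : ℕ) (e : ℕ → Edge n) → ClosedGeodesic m e → IsTriangle e ⊎ IsBackAndForth e)
    × (∀ (n : ℕ) (V₀ : Fin n → Set) (E₀ : Edge n → Set) → IsSubgraph V₀ E₀ → ((Connected V₀ E₀ × TotallyGeodesic V₀ E₀ → Complete V₀ E₀) × (Complete V₀ E₀ → Connected V₀ E₀ × TotallyGeodesic V₀ E₀)))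
mainTheorem12 =
  (λ n m e G → let open ClosedGeodesic G in
               GeodesicSequence.triangle-or-back-and-forth e chain geodesic) ,
  (λ n V₀ E₀ S → uncurry (connected∧totallyGeodesic⇒complete S) ,
                 < complete⇒connected , complete⇒totallyGeodesic >)
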